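{- Let $\mathcal{F}$ be the set of positive linear fractional transformations and $\mathcal{O}\subseteq\mathcal{F}$ the set of orphans. For each $w^*\in\mathcal{O}$, $\mathcal{T}(w^*)$ is a rooted infinite binary tree with root $w^*$. The vertex sets of the trees $\mathcal{T}(w^*)$, $w^*\in\mathcal{O}$, are pairwise disjoint and their union is $\mathcal{F}$. For every nonzero integer $D$, let $\mathcal{F}(D)$ be the set of positive linear fractional transformations of determinant $D$ and $\mathcal{O}(D)$ the set of orphans of determinant $D$. Then $\mathcal{O}(D)$ is finite, and the trees $\mathcal{T}(w^*)$, $w^*\in\mathcal{O}(D)$, partition $\mathcal{F}(D)$ into pairwise disjoint rooted infinite binary trees.
   Context: Let $z$ be a variable. A positive linear fractional transformation is an expression $w=\frac{az+b}{cz+d}$ with $a,b,c,d\in\mathbb{N}_0=\{0,1,2,\dots\}$ and $ad-bc\neq0$, identified with its coefficient matrix. Its determinant is $ad-bc$. Its left child is $\frac{w}{w+1}:=\frac{az+b}{(a+c)z+(b+d)}$ and its right child is $w+1:=\frac{(a+c)z+(b+d)}{cz+d}$. The transformation $\frac{az+b}{cz+d}$ is an orphan if neither ($a\le c$ and $b\le d$) nor ($c\le a$ and $d\le b$) holds. Equivalently, it is not a child of any positive linear fractional transformation. For a positive linear fractional transformation $w^*$, $\mathcal{T}(w^*)$ is the directed graph defined as follows: - its vertices are $w^*$ and all expressions obtained from $w^*$ by finitely many applications of the two child operations; - it has an edge from each vertex to each of its two children. A rooted infinite binary tree is a directed graph with the following three properties: - every vertex is the tail of exactly two edges; - there is a root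 that is the head of no edge, while every other vertex is the head of exactly one edge; - the underlying graph is connected. -}

module Defs where

open import Data.Nat using (ℕ; _+_; _*_; _≤_)
open import Data.Integer as ℤ using (ℤ; +_; _-_)
open import Data.Product using (Σ; ∃; _×_; _,_)
open import Data.Sum using (_⊎_)
open import Data.List using (List)
open import Data.List.Membership.Propositional using (_∈_)
open import Relation.Nullary using (¬_)
open import Relation.Binary.PropositionalEquality using (_≡_; _≢_)

-- Coefficient matrix (a b / c d) of  (a z + b) / (c z + d),  a,b,c,d ∈ ℕ₀.
record Mat : Set where
  constructor mat
  field
    a b c d : ℕ
open Mat public

det : Mat → ℤ
det (mat a b c d) = + (a * d) - + (b * c)

IsLFT : Mat → Set
IsLFT (mat a b c d) = a * d ≢ b * c

-- left child  w/(w+1) = (az+b)/((a+c)z+(b+d))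
leftChild : Mat → Mat
leftChild (mat a b c d) = mat a b (a + c) (b + d)

-- right child  w+1 = ((a+c)z+(b+d))/(cz+d)
rightChild : Mat → Mat
rightChild (mat a b c d) = mat (a + c) (b + d) c d

Orphan : Mat → Set
Orphan (mat a b c d) = ¬ ((a ≤ c × b ≤ d) ⊎ (c ≤ a × d ≤ b))

data Vertex (w* : Mat) : Mat → Set where
  root  : Vertex w* w*
  viaL  : ∀ {w} → Vertex w* w → Vertex w* (leftChild w)
  viaR  : ∀ {w} → Vertex w* w → Vertex w* (rightChild w)

Edge : Mat → Mat → Mat → Set
Edge w* u v = Vertex w* u × (v ≡ leftChild u ⊎ v ≡ rightChild u)

data UWalk (V : Mat → Set) (E : Mat → Mat → Set) : Mat → Mat → Set where
  here : ∀ {x} → V x → UWalk V E x x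
  fwd  : ∀ {x y z} → E y z → V z → UWalk V E x y → UWalk V E x z
  bwd  : ∀ {x y z} → E z y → V z → UWalk V E x y → UWalk V E x z

record IsRootedInfiniteBinaryTree (V : Mat → Set) (E : Mat → Mat → Set) (r : Mat) : Set where
  field
    edgesInV   : ∀ u v → E u v → V u × V v
    twoOut     : ∀ v → V v → Σ Mat λ u₁ → Σ Mat λ u₂ →
                   u₁ ≢ u₂ × E v u₁ × E v u₂ × (∀ u → E v u → u ≡ u₁ ⊎ u ≡ u₂)
    rootInV    : V r
    rootNoIn   : ∀ u → ¬ E u r
    oneIn      : ∀ v → V v → v ≢ r →
                   Σ Mat λ u → E u v × (∀ u' → E u' v → u' ≡ u)
    connected  : ∀ v → V v → UWalk V E r v

Finite : (Mat → Set) → Set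
Finite P = ∃ λ (L : List Mat) → ∀ w → P w → w ∈ L

module Submission where

-- Everything rests on three elementary facts about the child operations
--   leftChild (a b / c d) = (a b / a+c b+d),  rightChild (a b / c d) = (a+c b+d / c d):
--   (1) they preserve the determinant, hence also being an LFT (det ≠ 0);
--   (2) a left child has its bottom row dominating its top row, a right
--       child the reverse; an LFT cannot have both shapes, so an LFT is the
--       child of at most one matrix, and it is a child exactly when it is not
--       an orphan (parent = difference of the rows);
--   (3) the parent has strictly smaller entry sum.
-- From (1)-(2) each T(o) is a rooted infinite binary tree and two trees with
-- orphan roots sharing a vertex have the same root (walk up parents).  From
-- (2)-(3), repeatedly passing to the parent reaches an orphan, so every LFT
-- lies in some tree, with the same determinant by (1).  Finally an orphan
-- has c < a, b < d or a < c, d < b, which forces all entries ≤ |det|, so the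
-- orphans of a fixed determinant lie in an explicit finite list.

open import Defs
open import Data.Integer using (ℤ; +_; ∣_∣)
open import Data.Nat using (ℕ; zero; suc; _+_; _*_; _∸_; _≤_; _<_; _≤?_; s≤s; z≤n)
open import Data.Nat.Properties
open import Data.Nat.Induction using (<-wellFounded)
open import Data.Nat.Tactic.RingSolver using (solve-∀)
import Data.Integer as ℤ
import Data.Integer.Properties as ℤP
open import Data.Product using (Σ; _×_; _,_; proj₁; proj₂)
open import Data.Sum using (_⊎_; inj₁; inj₂; [_,_])
open import Data.Empty using (⊥; ⊥-elim)
open import Data.List using (List; map; upTo; cartesianProduct)
open import Data.List.Membership.Propositional using (_∈_)
open import Data.List.Membership.Propositional.Properties using (∈-map⁺; ∈-cartesianProduct⁺; ∈-upTo⁺)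
open import Induction.WellFounded using (Acc; acc)
open import Relation.Nullary using (¬_; yes; no)
open import Relation.Nullary.Decidable using (_×-dec_)
open import Relation.Binary.PropositionalEquality using (_≡_; _≢_; refl; sym; trans; cong; cong₂; subst; module ≡-Reasoning)

ChildOf : Mat → Mat → Set
ChildOf w u = w ≡ leftChild u ⊎ w ≡ rightChild u

LeftShaped : Mat → Set
LeftShaped (mat a b c d) = a ≤ c × b ≤ d

RightShaped : Mat → Set
RightShaped (mat a b c d) = c ≤ a × d ≤ b

leftChild-shaped : ∀ u → LeftShaped (leftChild u)
leftChild-shaped (mat a b c d) = m≤m+n a c , m≤m+n b d

rightChild-shaped : ∀ u → RightShaped (rightChild u)
rightChild-shaped (mat a b c d) = m≤n+m c a , m≤n+m d b

-- Both shapes at once means equal rows, i.e. determinant zero.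
shapes-exclusive : ∀ w → IsLFT w → LeftShaped w → RightShaped w → ⊥
shapes-exclusive (mat a b c d) lft (a≤c , b≤d) (c≤a , d≤b)
  with ≤-antisym a≤c c≤a | ≤-antisym b≤d d≤b
... | refl | refl = lft (*-comm a b)

leftChild≢rightChild : ∀ {u v} → IsLFT (leftChild u) → leftChild u ≢ rightChild v
leftChild≢rightChild {u} {v} lft e =
  shapes-exclusive (leftChild u) lft (leftChild-shaped u)
    (subst RightShaped (sym e) (rightChild-shaped v))

leftChild-injective : ∀ {u v} → leftChild u ≡ leftChild v → u ≡ v
leftChild-injective {mat a b c d} {mat _ _ c' d'} e with cong Mat.a e | cong Mat.b e
... | refl | refl =
  cong₂ (mat a b) (+-cancelˡ-≡ a c c' (cong Mat.c e)) (+-cancelˡ-≡ b d d' (cong Mat.d e))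

rightChild-injective : ∀ {u v} → rightChild u ≡ rightChild v → u ≡ v
rightChild-injective {mat a b c d} {mat a' b' _ _} e with cong Mat.c e | cong Mat.d e
... | refl | refl =
  cong₂ (λ x y → mat x y c d) (+-cancelʳ-≡ c a a' (cong Mat.a e)) (+-cancelʳ-≡ d b b' (cong Mat.b e))

parent-unique : ∀ {w u v} → IsLFT w → ChildOf w u → ChildOf w v → u ≡ v
parent-unique _ (inj₁ refl) (inj₁ e) = leftChild-injective e
parent-unique lft (inj₁ refl) (inj₂ e) = ⊥-elim (leftChild≢rightChild lft e)
parent-unique lft (inj₂ refl) (inj₁ e) = ⊥-elim (leftChild≢rightChild (subst IsLFT e lft) (sym e))
parent-unique _ (inj₂ refl) (inj₂ e) = rightChild-injective e

orphan-has-no-parent : ∀ {w u} → Orphan w → ¬ ChildOf w u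
orphan-has-no-parent {u = u} orph (inj₁ refl) = orph (inj₁ (leftChild-shaped u))
orphan-has-no-parent {u = u} orph (inj₂ refl) = orph (inj₂ (rightChild-shaped u))

-- Conversely a non-orphan is a child: its parent is obtained by subtracting
-- the dominated row from the dominating one.
orphan-or-child : ∀ w → Orphan w ⊎ Σ Mat (ChildOf w)
orphan-or-child (mat a b c d) with (a ≤? c) ×-dec (b ≤? d) | (c ≤? a) ×-dec (d ≤? b)
... | yes (a≤c , b≤d) | _ =
  inj₂ (mat a b (c ∸ a) (d ∸ b) , inj₁ (sym (cong₂ (mat a b) (m+[n∸m]≡n a≤c) (m+[n∸m]≡n b≤d))))
... | no _ | yes (c≤a , d≤b) =
  inj₂ (mat (a ∸ c) (b ∸ d) c d , inj₂ (sym (cong₂ (λ x y → mat x y c d) (m∸n+n≡m c≤a) (m∸n+n≡m d≤b))))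
... | no ¬left | no ¬right = inj₁ [ ¬left , ¬right ]

cancel-common-summand : ∀ k m n → + (k + m) ℤ.- + (k + n) ≡ + m ℤ.- + n
cancel-common-summand k m n = begin
  + (k + m) ℤ.- + (k + n)  ≡⟨ ℤP.m-n≡m⊖n (k + m) (k + n) ⟩
  (k + m) ℤ.⊖ (k + n)      ≡⟨ ℤP.+-cancelˡ-⊖ k m n ⟩
  m ℤ.⊖ n                  ≡⟨ ℤP.m-n≡m⊖n m n ⟨
  + m ℤ.- + n              ∎
  where open ≡-Reasoning

det-leftChild : ∀ u → det (leftChild u) ≡ det u
det-leftChild (mat a b c d) = begin
  + (a * (b + d)) ℤ.- + (b * (a + c))     ≡⟨ cong₂ (λ x y → + x ℤ.- + y) (expandˡ a b d) (expandʳ a b c) ⟩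
  + (a * b + a * d) ℤ.- + (a * b + b * c) ≡⟨ cancel-common-summand (a * b) (a * d) (b * c) ⟩
  + (a * d) ℤ.- + (b * c)                 ∎
  where
  open ≡-Reasoning
  expandˡ : ∀ a b d → a * (b + d) ≡ a * b + a * d
  expandˡ = solve-∀
  expandʳ : ∀ a b c → b * (a + c) ≡ a * b + b * c
  expandʳ = solve-∀

det-rightChild : ∀ u → det (rightChild u) ≡ det u
det-rightChild (mat a b c d) = begin
  + ((a + c) * d) ℤ.- + ((b + d) * c)     ≡⟨ cong₂ (λ x y → + x ℤ.- + y) (expandˡ a c d) (expandʳ b c d) ⟩
  + (c * d + a * d) ℤ.- + (c * d + b * c) ≡⟨ cancel-common-summand (c * d) (a * d) (b * c) ⟩
  + (a * d) ℤ.- + (b * c)                 ∎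
  where
  open ≡-Reasoning
  expandˡ : ∀ a c d → (a + c) * d ≡ c * d + a * d
  expandˡ = solve-∀
  expandʳ : ∀ b c d → (b + d) * c ≡ c * d + b * c
  expandʳ = solve-∀

det-child : ∀ {w u} → ChildOf w u → det w ≡ det u
det-child {u = u} (inj₁ refl) = det-leftChild u
det-child {u = u} (inj₂ refl) = det-rightChild u

-- Being an LFT is having nonzero determinant, so it depends on det only.
LFT-by-det : ∀ u v → det u ≡ det v → IsLFT u → IsLFT v
LFT-by-det (mat a b c d) (mat a' b' c' d') e lft a'd'≡b'c' =
  lft (ℤP.+-injective (ℤP.i-j≡0⇒i≡j _ _ (trans e (ℤP.i≡j⇒i-j≡0 (cong +_ a'd'≡b'c')))))

det-vertex : ∀ {o w} → Vertex o w → det w ≡ det o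
det-vertex root         = refl
det-vertex (viaL {u} v) = trans (det-leftChild u) (det-vertex v)
det-vertex (viaR {u} v) = trans (det-rightChild u) (det-vertex v)

LFT-vertex : ∀ {o w} → IsLFT o → Vertex o w → IsLFT w
LFT-vertex {o} {w} lft v = LFT-by-det o w (sym (det-vertex v)) lft

vertex-view : ∀ {o w} → Vertex o w → w ≡ o ⊎ Σ Mat λ u → Edge o u w
vertex-view root     = inj₁ refl
vertex-view (viaL v) = inj₂ (_ , v , inj₁ refl)
vertex-view (viaR v) = inj₂ (_ , v , inj₂ refl)

tree : (o : Mat) → IsLFT o → Orphan o → IsRootedInfiniteBinaryTree (Vertex o) (Edge o) o
tree o lft orph = record
  { edgesInV  = λ { _ _ (v , inj₁ refl) → v , viaL v ; _ _ (v , inj₂ refl) → v , viaR v }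
  ; twoOut    = λ w v → leftChild w , rightChild w ,
                  leftChild≢rightChild (LFT-vertex lft (viaL v)) ,
                  (v , inj₁ refl) , (v , inj₂ refl) , (λ _ → proj₂)
  ; rootInV   = root
  ; rootNoIn  = λ u e → orphan-has-no-parent orph (proj₂ e)
  ; oneIn     = one-parent
  ; connected = λ _ → walk-from-root
  }
  where
  one-parent : ∀ w → Vertex o w → w ≢ o → Σ Mat λ u → Edge o u w × (∀ u' → Edge o u' w → u' ≡ u)
  one-parent w v w≢o with vertex-view v
  ... | inj₁ w≡o = ⊥-elim (w≢o w≡o)
  ... | inj₂ (u , edge) =
    u , edge , λ u' edge' → parent-unique (LFT-vertex lft v) (proj₂ edge') (proj₂ edge)

  walk-from-root : ∀ {w} → Vertex o w → UWalk (Vertex o) (Edge o) o w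
  walk-from-root root     = here root
  walk-from-root (viaL v) = fwd (v , inj₁ refl) (viaL v) (walk-from-root v)
  walk-from-root (viaR v) = fwd (v , inj₂ refl) (viaR v) (walk-from-root v)

-- Walk up from w in T(o₁); parents in T(o₂) agree by uniqueness of parents,
-- and an orphan cannot appear strictly below the root of a tree.
roots-agree : ∀ {o₁ o₂ w} → IsLFT o₁ → Orphan o₁ → Orphan o₂ →
              Vertex o₁ w → Vertex o₂ w → o₁ ≡ o₂
roots-agree-via : ∀ {o₁ o₂ u w} → IsLFT o₁ → Orphan o₁ → Orphan o₂ →
                  Vertex o₁ u → ChildOf w u → Vertex o₂ w → o₁ ≡ o₂

roots-agree lft orph₁ orph₂ root q with vertex-view q
... | inj₁ o₁≡o₂        = o₁≡o₂
... | inj₂ (_ , _ , c) = ⊥-elim (orphan-has-no-parent orph₁ c)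
roots-agree lft orph₁ orph₂ (viaL p) q = roots-agree-via lft orph₁ orph₂ p (inj₁ refl) q
roots-agree lft orph₁ orph₂ (viaR p) q = roots-agree-via lft orph₁ orph₂ p (inj₂ refl) q

roots-agree-via {o₂ = o₂} {u} {w} lft orph₁ orph₂ p c q with vertex-view q
... | inj₁ refl = ⊥-elim (orphan-has-no-parent orph₂ c)
... | inj₂ (u' , q' , c') =
  roots-agree lft orph₁ orph₂ p (subst (Vertex o₂) (parent-unique lftw c' c) q')
  where
  lftw : IsLFT w
  lftw = LFT-by-det u w (sym (det-child c)) (LFT-vertex lft p)

-- The entry sum, which strictly decreases from an LFT to its parent.
size : Mat → ℕ
size (mat a b c d) = a + b + c + d

top-row-nonzero : ∀ w → IsLFT w → 0 < Mat.a w + Mat.b w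
top-row-nonzero (mat (suc a) b c d) _ = s≤s z≤n
top-row-nonzero (mat zero (suc b) c d) _ = s≤s z≤n
top-row-nonzero (mat zero zero c d) lft = ⊥-elim (lft refl)

bottom-row-nonzero : ∀ w → IsLFT w → 0 < Mat.c w + Mat.d w
bottom-row-nonzero (mat a b (suc c) d) _ = s≤s z≤n
bottom-row-nonzero (mat a b zero (suc d)) _ = s≤s z≤n
bottom-row-nonzero (mat a b zero zero) lft = ⊥-elim (lft (trans (*-zeroʳ a) (sym (*-zeroʳ b))))

-- (3) A child adds the other row of its parent to one row, so the parent
-- of an LFT is strictly smaller.
parent-smaller : ∀ {w u} → IsLFT w → ChildOf w u → size u < size w
parent-smaller {u = mat a b c d} lft (inj₁ refl) =
  subst (size (mat a b c d) <_) (grows a b c d) (m<m+n _ (top-row-nonzero (mat a b (a + c) (b + d)) lft))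
  where
  grows : ∀ a b c d → a + b + c + d + (a + b) ≡ a + b + (a + c) + (b + d)
  grows = solve-∀
parent-smaller {u = mat a b c d} lft (inj₂ refl) =
  subst (size (mat a b c d) <_) (grows a b c d) (m<m+n _ (bottom-row-nonzero (mat (a + c) (b + d) c d) lft))
  where
  grows : ∀ a b c d → a + b + c + d + (c + d) ≡ a + c + (b + d) + c + d
  grows = solve-∀

OrphanRooted : Mat → Set
OrphanRooted w = Σ Mat λ o → IsLFT o × Orphan o × Vertex o w

orphan-rooted-child : ∀ {w u} → ChildOf w u → OrphanRooted u → OrphanRooted w
orphan-rooted-child (inj₁ refl) (o , lft , orph , v) = o , lft , orph , viaL v
orphan-rooted-child (inj₂ refl) (o , lft , orph , v) = o , lft , orph , viaR v

-- Part 4: pass to parents until an orphan is reached; this terminates by (3).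
orphan-ancestor : ∀ w → IsLFT w → OrphanRooted w
orphan-ancestor w = go w (<-wellFounded (size w))
  where
  go : ∀ w → Acc _<_ (size w) → IsLFT w → OrphanRooted w
  go w (acc smaller) lft with orphan-or-child w
  ... | inj₁ orph       = w , lft , orph , root
  ... | inj₂ (u , c) =
    orphan-rooted-child c (go u (smaller (parent-smaller lft c)) (LFT-by-det w u (det-child c) lft))

-- If q < x and p < y then the product x y exceeds p q by at least x and by
-- at least y: writing x = 1 + x', y = 1 + y', we have p q ≤ y' x'.
dominant-product : ∀ {x y p q} → q < x → p < y → (x + p * q ≤ x * y) × (y + p * q ≤ x * y)
dominant-product {suc x} {suc y} {p} {q} (s≤s q≤x) (s≤s p≤y) =
  ≤-trans (+-monoʳ-≤ (suc x) (≤-trans pq≤yx (m≤n+m (y * x) y))) (≤-reflexive (expand₁ x y)) ,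
  ≤-trans (+-monoʳ-≤ (suc y) (≤-trans pq≤yx (m≤n+m (y * x) x))) (≤-reflexive (expand₂ x y))
  where
  pq≤yx : p * q ≤ y * x
  pq≤yx = *-mono-≤ p≤y q≤x
  expand₁ : ∀ x y → suc x + (y + y * x) ≡ suc x * suc y
  expand₁ = solve-∀
  expand₂ : ∀ x y → suc y + (x + y * x) ≡ suc x * suc y
  expand₂ = solve-∀

orphan-shape : ∀ {a b c d} → Orphan (mat a b c d) → (c < a × b < d) ⊎ (a < c × d < b)
orphan-shape {a} {b} {c} {d} orph with ≤-total a c
... | inj₁ a≤c = inj₂ (a<c , d<b)
  where
  d<b : d < b
  d<b = ≰⇒> λ b≤d → orph (inj₁ (a≤c , b≤d))
  a<c : a < c
  a<c = ≰⇒> λ c≤a → orph (inj₂ (c≤a , <⇒≤ d<b))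
... | inj₂ c≤a = inj₁ (c<a , b<d)
  where
  b<d : b < d
  b<d = ≰⇒> λ d≤b → orph (inj₂ (c≤a , d≤b))
  c<a : c < a
  c<a = ≰⇒> λ a≤c → orph (inj₁ (a≤c , <⇒≤ b<d))

Bounded : ℕ → Mat → Set
Bounded k (mat a b c d) = a ≤ k × b ≤ k × c ≤ k × d ≤ k

abs-det-≥ : ∀ a b c d → b * c ≤ a * d → ∣ det (mat a b c d) ∣ ≡ a * d ∸ b * c
abs-det-≥ a b c d le = begin
  ∣ + (a * d) ℤ.- + (b * c) ∣  ≡⟨ cong ∣_∣ (ℤP.m-n≡m⊖n (a * d) (b * c)) ⟩
  ∣ (a * d) ℤ.⊖ (b * c) ∣      ≡⟨ ℤP.∣m⊖n∣≡∣n⊖m∣ (a * d) (b * c) ⟩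
  ∣ (b * c) ℤ.⊖ (a * d) ∣      ≡⟨ ℤP.∣⊖∣-≤ le ⟩
  a * d ∸ b * c                ∎
  where open ≡-Reasoning

abs-det-≤ : ∀ a b c d → a * d ≤ b * c → ∣ det (mat a b c d) ∣ ≡ b * c ∸ a * d
abs-det-≤ a b c d le = trans (cong ∣_∣ (ℤP.m-n≡m⊖n (a * d) (b * c))) (ℤP.∣⊖∣-≤ le)

diagonal-bounded : ∀ {a b c d} → c < a → b < d → Bounded ∣ det (mat a b c d) ∣ (mat a b c d)
diagonal-bounded {a} {b} {c} {d} c<a b<d =
  subst (λ k → Bounded k (mat a b c d)) (sym (abs-det-≥ a b c d (m+n≤o⇒n≤o a a+bc≤ad)))
    (a≤k , ≤-trans (<⇒≤ b<d) d≤k , ≤-trans (<⇒≤ c<a) a≤k , d≤k)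
  where
  a+bc≤ad : a + b * c ≤ a * d
  a+bc≤ad = proj₁ (dominant-product c<a b<d)
  a≤k : a ≤ a * d ∸ b * c
  a≤k = m+n≤o⇒m≤o∸n a a+bc≤ad
  d≤k : d ≤ a * d ∸ b * c
  d≤k = m+n≤o⇒m≤o∸n d (proj₂ (dominant-product c<a b<d))

antidiagonal-bounded : ∀ {a b c d} → a < c → d < b → Bounded ∣ det (mat a b c d) ∣ (mat a b c d)
antidiagonal-bounded {a} {b} {c} {d} a<c d<b =
  subst (λ k → Bounded k (mat a b c d)) (sym (abs-det-≤ a b c d (m+n≤o⇒n≤o b b+ad≤bc)))
    (≤-trans (<⇒≤ a<c) c≤k , b≤k , c≤k , ≤-trans (<⇒≤ d<b) b≤k)
  where
  b+ad≤bc : b + a * d ≤ b * c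
  b+ad≤bc = proj₁ (dominant-product d<b a<c)
  b≤k : b ≤ b * c ∸ a * d
  b≤k = m+n≤o⇒m≤o∸n b b+ad≤bc
  c≤k : c ≤ b * c ∸ a * d
  c≤k = m+n≤o⇒m≤o∸n c (proj₂ (dominant-product d<b a<c))

orphan-bounded : ∀ w → Orphan w → Bounded ∣ det w ∣ w
orphan-bounded (mat a b c d) orph with orphan-shape orph
... | inj₁ (c<a , b<d) = diagonal-bounded c<a b<d
... | inj₂ (a<c , d<b) = antidiagonal-bounded a<c d<b

matrices-up-to : ℕ → List Mat
matrices-up-to k = map toMat (cartesianProduct R (cartesianProduct R (cartesianProduct R R)))
  where
  R : List ℕ
  R = upTo (suc k)
  toMat : ℕ × ℕ × ℕ × ℕ → Mat
  toMat (a , b , c , d) = mat a b c d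

bounded-listed : ∀ k w → Bounded k w → w ∈ matrices-up-to k
bounded-listed k (mat a b c d) (a≤k , b≤k , c≤k , d≤k) =
  ∈-map⁺ _ (∈-cartesianProduct⁺ (∈-upTo⁺ (s≤s a≤k))
             (∈-cartesianProduct⁺ (∈-upTo⁺ (s≤s b≤k))
               (∈-cartesianProduct⁺ (∈-upTo⁺ (s≤s c≤k)) (∈-upTo⁺ (s≤s d≤k)))))

orphans-finite : (D : ℤ) → Finite (λ w → IsLFT w × Orphan w × det w ≡ D)
orphans-finite D = matrices-up-to ∣ D ∣ , λ w (_ , orph , det≡D) →
  bounded-listed ∣ D ∣ w (subst (λ k → Bounded k w) (cong ∣_∣ det≡D) (orphan-bounded w orph))

mainTheorem10 :
    ((o : Mat) → IsLFT o → Orphan o →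
       IsRootedInfiniteBinaryTree (Vertex o) (Edge o) o)
    × ((o₁ o₂ w : Mat) → IsLFT o₁ → Orphan o₁ → IsLFT o₂ → Orphan o₂ →
       Vertex o₁ w → Vertex o₂ w → o₁ ≡ o₂)
    × ((o w : Mat) → IsLFT o → Orphan o → Vertex o w → IsLFT w)
    × ((w : Mat) → IsLFT w → Σ Mat λ o → IsLFT o × Orphan o × Vertex o w)
    × ((D : ℤ) → D ≢ + 0 →
       Finite (λ w → IsLFT w × Orphan w × det w ≡ D)
       × ((o w : Mat) → IsLFT o → Orphan o → det o ≡ D → Vertex o w →
            IsLFT w × det w ≡ D)
       × ((w : Mat) → IsLFT w → det w ≡ D →
            Σ Mat λ o → IsLFT o × Orphan o × det o ≡ D × Vertex o w))
mainTheorem10 =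
  tree ,
  (λ _ _ _ lft₁ orph₁ _ orph₂ → roots-agree lft₁ orph₁ orph₂) ,
  (λ _ _ lft _ → LFT-vertex lft) ,
  orphan-ancestor ,
  λ D _ →
    orphans-finite D ,
    (λ _ _ lft _ det≡D v → LFT-vertex lft v , trans (det-vertex v) det≡D) ,
    λ w lft det≡D →
      let (o , lftₒ , orph , v) = orphan-ancestor w lft
      in  o , lftₒ , orph , trans (sym (det-vertex v)) det≡D , v
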